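{- Let $D=(A,B,\lambda)$ be a temporal bi-clique with $A,B$ nonempty and $\lambda$ injective. Let $a\in A$ and $b=\pi^-(a)$; then $a=\pi^-(b)$ or $\pi^-(b)$ is dismountable. Let $b\in B$ and $a=\pi^+(b)$; then $\pi^+(a)=b$ or $\pi^+(a)$ is dismountable.
   Context: A temporal bi-clique $(A,B,\lambda)$ is the complete bipartite graph with disjoint parts $A,B$ with an edge labeling $\lambda$ into $\mathbb{N}$. For a vertex $v$, $\pi^-(v)$ is the neighbor $u$ of $v$ minimizing $\lambda(\{v,u\})$ (earliest neighbor) and $\pi^+(v)$ the neighbor maximizing it (latest neighbor). A vertex $a\in A$ is dismountable if there is $a'\in A$, $a'\ne a$, with $\lambda(\{a,\pi^-(a')\})\le\lambda(\{a',\pi^-(a')\})$. A vertex $b\in B$ is dismountable if there is $b'\in B$, $b'\ne b$, with $\lambda(\{b',\pi^+(b')\})\le\lambda(\{b,\pi^+(b')\})$. -}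

module Defs where

open import Data.Nat using (ℕ; suc; _≤_; _≤?_)
open import Data.Fin using (Fin; zero; suc)
open import Data.Product using (Σ; ∃; _×_; _,_)
open import Relation.Nullary using (¬_; yes; no)
open import Relation.Binary.PropositionalEquality using (_≡_)

-- argmin / argmax of a function on a nonempty finite set Fin (suc k).
-- (Ties broken towards the smaller index; irrelevant when λ is injective.)
argmin : ∀ {k} → (Fin (suc k) → ℕ) → Fin (suc k)
argmin {ℕ.zero} f = zero
argmin {suc k} f with argmin {k} (λ i → f (suc i))
... | j with f zero ≤? f (suc j)
...   | yes _ = zero
...   | no _  = suc j

argmax : ∀ {k} → (Fin (suc k) → ℕ) → Fin (suc k)
argmax {ℕ.zero} f = zero
argmax {suc k} f with argmax {k} (λ i → f (suc i))
... | j with f (suc j) ≤? f zero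
...   | yes _ = zero
...   | no _  = suc j

-- A temporal bi-clique with A = Fin (suc m), B = Fin (suc n) (both nonempty);
-- the labeling of edge {a,b} is  lab a b.
Labeling : ℕ → ℕ → Set
Labeling m n = Fin (suc m) → Fin (suc n) → ℕ

Injective : ∀ {m n} → Labeling m n → Set
Injective {m} {n} lab = ∀ (a a' : Fin (suc m)) (b b' : Fin (suc n)) →
  lab a b ≡ lab a' b' → (a ≡ a') × (b ≡ b')

module _ {m n : ℕ} (lab : Labeling m n) where
  π⁻A : Fin (suc m) → Fin (suc n)
  π⁻A a = argmin (λ b → lab a b)

  π⁺A : Fin (suc m) → Fin (suc n)
  π⁺A a = argmax (λ b → lab a b)

  π⁻B : Fin (suc n) → Fin (suc m)
  π⁻B b = argmin (λ a → lab a b)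

  π⁺B : Fin (suc n) → Fin (suc m)
  π⁺B b = argmax (λ a → lab a b)

  DismountableA : Fin (suc m) → Set
  DismountableA a = Σ (Fin (suc m)) λ a' → ¬ (a' ≡ a) ×
    (lab a (π⁻A a') ≤ lab a' (π⁻A a'))

  DismountableB : Fin (suc n) → Set
  DismountableB b = Σ (Fin (suc n)) λ b' → ¬ (b' ≡ b) ×
    (lab (π⁺B b') b' ≤ lab (π⁺B b') b)

-- If a' = π⁻(π⁻(a)) differs from a, then a itself witnesses that a' is
-- dismountable: the edge {a', π⁻(a)} is the earliest at π⁻(a), so it is no
-- later than {a, π⁻(a)}, and π⁻(a) is the earliest neighbour of a.

module Submission where

open import Defs
open import Data.Nat using (ℕ; suc; _≤_; _≤?_)
open import Data.Nat.Properties using (≤-refl; ≤-trans; ≰⇒≥)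
open import Data.Fin using (Fin; zero; suc)
open import Data.Fin.Properties using (_≟_)
open import Data.Product using (_×_; _,_)
open import Data.Sum using (_⊎_; inj₁; inj₂)
open import Relation.Nullary using (yes; no)
open import Relation.Binary.PropositionalEquality using (_≡_; _≢_; ≢-sym)

argmin-minimal : ∀ {k} (f : Fin (suc k) → ℕ) (i : Fin (suc k)) → f (argmin f) ≤ f i
argmin-minimal {ℕ.zero} f zero = ≤-refl
argmin-minimal {suc k} f i with argmin (λ i → f (suc i)) | argmin-minimal (λ i → f (suc i))
... | j | minimal with f zero ≤? f (suc j)
argmin-minimal {suc k} f zero    | j | minimal | yes f₀≤fⱼ = ≤-refl
argmin-minimal {suc k} f (suc i) | j | minimal | yes f₀≤fⱼ = ≤-trans f₀≤fⱼ (minimal i)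
argmin-minimal {suc k} f zero    | j | minimal | no f₀≰fⱼ  = ≰⇒≥ f₀≰fⱼ
argmin-minimal {suc k} f (suc i) | j | minimal | no f₀≰fⱼ  = minimal i

argmax-maximal : ∀ {k} (f : Fin (suc k) → ℕ) (i : Fin (suc k)) → f i ≤ f (argmax f)
argmax-maximal {ℕ.zero} f zero = ≤-refl
argmax-maximal {suc k} f i with argmax (λ i → f (suc i)) | argmax-maximal (λ i → f (suc i))
... | j | maximal with f (suc j) ≤? f zero
argmax-maximal {suc k} f zero    | j | maximal | yes fⱼ≤f₀ = ≤-refl
argmax-maximal {suc k} f (suc i) | j | maximal | yes fⱼ≤f₀ = ≤-trans (maximal i) fⱼ≤f₀
argmax-maximal {suc k} f zero    | j | maximal | no fⱼ≰f₀  = ≰⇒≥ fⱼ≰f₀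
argmax-maximal {suc k} f (suc i) | j | maximal | no fⱼ≰f₀  = maximal i

module _ {m n : ℕ} (lab : Labeling m n) where

  π⁻B∘π⁻A-dismountable : ∀ a → π⁻B lab (π⁻A lab a) ≢ a →
                         DismountableA lab (π⁻B lab (π⁻A lab a))
  π⁻B∘π⁻A-dismountable a a'≢a =
    a , ≢-sym a'≢a , argmin-minimal (λ x → lab x (π⁻A lab a)) a

  π⁺A∘π⁺B-dismountable : ∀ b → π⁺A lab (π⁺B lab b) ≢ b →
                         DismountableB lab (π⁺A lab (π⁺B lab b))
  π⁺A∘π⁺B-dismountable b b'≢b =
    b , ≢-sym b'≢b , argmax-maximal (λ y → lab (π⁺B lab b) y) b

lemma13 : ∀ (m n : ℕ) (lab : Labeling m n) → Injective lab →
    (∀ a → π⁻B lab (π⁻A lab a) ≡ a ⊎ DismountableA lab (π⁻B lab (π⁻A lab a)))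
    × (∀ b → π⁺A lab (π⁺B lab b) ≡ b ⊎ DismountableB lab (π⁺A lab (π⁺B lab b)))
lemma13 m n lab _ = earliest , latest
  where
  earliest : ∀ a → π⁻B lab (π⁻A lab a) ≡ a ⊎ DismountableA lab (π⁻B lab (π⁻A lab a))
  earliest a with π⁻B lab (π⁻A lab a) ≟ a
  ... | yes a'≡a = inj₁ a'≡a
  ... | no  a'≢a = inj₂ (π⁻B∘π⁻A-dismountable lab a a'≢a)

  latest : ∀ b → π⁺A lab (π⁺B lab b) ≡ b ⊎ DismountableB lab (π⁺A lab (π⁺B lab b))
  latest b with π⁺A lab (π⁺B lab b) ≟ b
  ... | yes b'≡b = inj₁ b'≡b
  ... | no  b'≢b = inj₂ (π⁺A∘π⁺B-dismountable lab b b'≢b)
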